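{- Let $H=(V,E)$ be an oriented hypergraph that has an algebraic spanning tree over the integers. Then, with integer coefficients, $\operatorname{Im}\delta^0$ is a direct summand of $C^1$.
   Context: An oriented hypergraph $H=(V,E)$ consists of a finite set $V$ and a set $E$ of ordered pairs $(A,B)$ of disjoint subsets of $V$, where $E$ never contains both $(A,B)$ and $(B,A)$. $C_0,C_1$ are the free $\mathbb Z$-modules with bases $V,E$; $\partial_1\colon C_1\to C_0$ is the linear extension of $(A,B)\mapsto\sum_{v\in B}v-\sum_{v\in A}v$; $C^0=\mathrm{Hom}(C_0,\mathbb Z)$, $C^1=\mathrm{Hom}(C_1,\mathbb Z)$; $\delta^0(\varphi)=\varphi\circ\partial_1$. $\gamma_1\colon C_1\to C^1$ with $\gamma_1(e)(e')=\delta_{ee'}$; $\langle\,,\rangle$ is the bilinear form on $C_1$ with $\langle e,e'\rangle=\delta_{ee'}$; $\mathcal C:=\operatorname{Ker}\partial_1$, $\mathcal B:=\gamma_1^{ -1}(\operatorname{Im}\delta^0)$. $T\subseteq E$ is an algebraic spanning tree over the integers if (1) $\mathcal B$ has a $\mathbb Z$-basis $(x_t\mid t\in T)$ with $\langle x_t,t'\rangle=\delta_{tt'}$ for all $t,t'\in T$, and (2) $\mathcal C$ has a $\mathbb Z$-basis $(x_e\mid e\in E\setminus T)$ with $\langle x_e,e'\rangle=\delta_{ee'}$ for all $e,e'\in E\setminus T$. -}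

module Defs where

open import Data.Nat using (ℕ)
open import Data.Fin using (Fin)
open import Data.Fin.Subset using (Subset)
open import Data.Bool using (Bool; true; false; if_then_else_)
open import Data.Vec using (lookup)
open import Data.Integer using (ℤ; +_; _+_; _-_; _*_; 0ℤ)
open import Data.Product using (Σ; _×_; ∃; ∃-syntax)
open import Data.Empty using (⊥)
open import Relation.Binary.PropositionalEquality using (_≡_)
open import Relation.Nullary using (yes; no)
open import Data.Fin using (_≟_)
open import Data.Fin.Subset using (∁)

Σℤ : ∀ {k} → (Fin k → ℤ) → ℤ
Σℤ {ℕ.zero}  f = 0ℤ
Σℤ {ℕ.suc k} f = f Fin.zero + Σℤ (λ i → f (Fin.suc i))

-- An oriented hypergraph with vertex set Fin n and edge set indexed by Fin m;
-- edge e is the ordered pair (tl e , hd e) = (A , B) of subsets of V.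
record OrientedHypergraph (n m : ℕ) : Set where
  field
    tl hd     : Fin m → Subset n
    disjoint  : ∀ e v → lookup (tl e) v ≡ true → lookup (hd e) v ≡ true → ⊥
    -- E is a set: distinct indices give distinct pairs
    distinct  : ∀ e e' → tl e ≡ tl e' → hd e ≡ hd e' → e ≡ e'
    noReverse : ∀ e e' → tl e ≡ hd e' → hd e ≡ tl e' → ⊥

open OrientedHypergraph public

C₀ C₁ : ℕ → Set
C₀ n = Fin n → ℤ
C₁ m = Fin m → ℤ
-- Hom(C_i, ℤ), written in coordinates w.r.t. the dual basis.
C⁰ C¹ : ℕ → Set
C⁰ n = Fin n → ℤ
C¹ m = Fin m → ℤ

ind : Bool → ℤ
ind b = if b then + 1 else 0ℤ

-- coefficient of vertex v in ∂₁ e = Σ_{v∈B} v − Σ_{v∈A} v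
inc : ∀ {n m} → OrientedHypergraph n m → Fin m → Fin n → ℤ
inc H e v = ind (lookup (hd H e) v) - ind (lookup (tl H e) v)

∂₁ : ∀ {n m} → OrientedHypergraph n m → C₁ m → C₀ n
∂₁ H x v = Σℤ (λ e → x e * inc H e v)

-- δ⁰ φ = φ ∘ ∂₁ ; its value on the basis element e
δ⁰ : ∀ {n m} → OrientedHypergraph n m → C⁰ n → C¹ m
δ⁰ H φ e = Σℤ (λ v → φ v * inc H e v)

-- γ₁(e)(e') = δ_{ee'} : in coordinates, the identity
γ₁ : ∀ {m} → C₁ m → C¹ m
γ₁ x = x

⟨_,_⟩ : ∀ {m} → C₁ m → Fin m → ℤ
⟨ x , e ⟩ = x e

_≋_ : ∀ {k} → (Fin k → ℤ) → (Fin k → ℤ) → Set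
x ≋ y = ∀ i → x i ≡ y i

𝟎 : ∀ {k} → Fin k → ℤ
𝟎 _ = 0ℤ

_⊕_ : ∀ {k} → (Fin k → ℤ) → (Fin k → ℤ) → (Fin k → ℤ)
(x ⊕ y) i = x i + y i

_·_ : ∀ {k} → ℤ → (Fin k → ℤ) → (Fin k → ℤ)
(c · x) i = c * x i

ImDelta0 : ∀ {n m} → OrientedHypergraph n m → C¹ m → Set
ImDelta0 {n} H y = ∃[ φ ] (δ⁰ H φ ≋ y)

KerDel1 : ∀ {n m} → OrientedHypergraph n m → C₁ m → Set
KerDel1 H x = ∂₁ H x ≋ 𝟎

-- ℬ = γ₁⁻¹ (Im δ⁰)
CutSpace : ∀ {n m} → OrientedHypergraph n m → C₁ m → Set
CutSpace H x = ImDelta0 H (γ₁ x)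

lincomb : ∀ {m k} → Subset m → (Fin m → ℤ) → (Fin m → (Fin k → ℤ)) → (Fin k → ℤ)
lincomb S c x i = Σℤ (λ e → if lookup S e then c e * x e i else 0ℤ)

IsBasisOn : ∀ {m k} → ((Fin k → ℤ) → Set) → Subset m → (Fin m → (Fin k → ℤ)) → Set
IsBasisOn M S x =
  (∀ e → lookup S e ≡ true → M (x e)) ×
  (∀ c → lincomb S c x ≋ 𝟎 → ∀ e → lookup S e ≡ true → c e ≡ 0ℤ) ×
  (∀ y → M y → ∃[ c ] (lincomb S c x ≋ y))

δ : ∀ {m} → Fin m → Fin m → ℤ
δ e e' with e ≟ e'
... | yes _ = + 1
... | no _  = 0ℤ

complement : ∀ {m} → Subset m → Subset m
complement = ∁

IsAlgebraicSpanningTree : ∀ {n m} → OrientedHypergraph n m → Subset m → Set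
IsAlgebraicSpanningTree {m = m} H T =
  (∃[ x ] (IsBasisOn (CutSpace H) T x ×
     (∀ t t' → lookup T t ≡ true → lookup T t' ≡ true → ⟨ x t , t' ⟩ ≡ δ t t'))) ×
  (∃[ x ] (IsBasisOn (KerDel1 H) (complement T) x ×
     (∀ e e' → lookup (complement T) e ≡ true → lookup (complement T) e' ≡ true →
        ⟨ x e , e' ⟩ ≡ δ e e')))

IsSubmodule : ∀ {k} → ((Fin k → ℤ) → Set) → Set
IsSubmodule P =
  P 𝟎 × (∀ x y → P x → P y → P (x ⊕ y)) × (∀ c x → P x → P (c · x)) ×
  (∀ x y → x ≋ y → P x → P y)

IsDirectSummand : ∀ {k} → ((Fin k → ℤ) → Set) → Set₁
IsDirectSummand {k} M =
  Σ ((Fin k → ℤ) → Set) λ N → IsSubmodule N ×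
    (∀ y → ∃[ a ] ∃[ b ] (M a × N b × (a ⊕ b) ≋ y)) ×
    (∀ y → M y → N y → y ≋ 𝟎)

-- Since γ₁ is the identity in coordinates, ℬ = Im δ⁰. Condition (1) of an algebraic
-- spanning tree T says that ℬ is generated by vectors x_t (t ∈ T) with x_t(t') = δ_tt'
-- on T. Hence y ↦ Σ_{t∈T} y(t) x_t is a projection of C¹ onto Im δ⁰, and its kernel,
-- the cochains vanishing on T, is a complement.
module Submission where

open import Defs
open import Data.Nat using (zero; suc)
open import Data.Fin using (Fin; zero; suc; _≟_)
open import Data.Fin.Properties using (suc-injective)
open import Data.Fin.Subset using (Subset)
open import Data.Bool using (true; false; if_then_else_)
open import Data.Vec using (lookup; []; _∷_)
open import Data.Integer using (ℤ; _+_; _-_; _*_; 0ℤ; 1ℤ)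
open import Data.Integer.Properties
  using (+-*-semiring; +-identityˡ; +-identityʳ; +-inverseʳ; *-identityʳ; *-zeroˡ; *-zeroʳ;
         *-distribʳ-+; *-assoc)
open import Data.Integer.Tactic.RingSolver using (solve-∀)
open import Algebra.Properties.Semiring.Sum +-*-semiring
  using (sum; sum-cong-≗; ∑-distrib-+; *-distribˡ-sum; sum-replicate-zero)
open import Data.Product using (∃-syntax; _,_; _×_)
open import Data.Empty using (⊥-elim)
open import Function using (_∘_)
open import Relation.Nullary using (yes; no)
open import Relation.Binary.PropositionalEquality
  using (_≡_; _≢_; refl; sym; trans; cong; cong₂; module ≡-Reasoning)

Σℤ≡sum : ∀ {k} (f : Fin k → ℤ) → Σℤ f ≡ sum f
Σℤ≡sum {zero}  f = refl
Σℤ≡sum {suc k} f = cong (f zero +_) (Σℤ≡sum (λ i → f (suc i)))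

Σℤ-zero : ∀ {k} (f : Fin k → ℤ) → (∀ i → f i ≡ 0ℤ) → Σℤ f ≡ 0ℤ
Σℤ-zero {k} f f≡0 = trans (Σℤ≡sum f) (trans (sum-cong-≗ f≡0) (sum-replicate-zero k))

Σℤ-single : ∀ {k} (t : Fin k) (f : Fin k → ℤ) → (∀ s → s ≢ t → f s ≡ 0ℤ) → Σℤ f ≡ f t
Σℤ-single zero f f≡0 =
  trans (cong (f zero +_) (Σℤ-zero (λ i → f (suc i)) λ i → f≡0 (suc i) λ ()))
        (+-identityʳ (f zero))
Σℤ-single (suc t) f f≡0 =
  trans (cong₂ _+_ (f≡0 zero λ ()) (Σℤ-single t (λ i → f (suc i)) tail≡0))
        (+-identityˡ (f (suc t)))
  where
  tail≡0 : ∀ s → s ≢ t → f (suc s) ≡ 0ℤ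
  tail≡0 s s≢t = f≡0 (suc s) (λ eq → s≢t (suc-injective eq))

δ-refl : ∀ {m} (t : Fin m) → δ t t ≡ 1ℤ
δ-refl t with t ≟ t
... | yes _   = refl
... | no t≢t = ⊥-elim (t≢t refl)

δ-≢ : ∀ {m} {s t : Fin m} → s ≢ t → δ s t ≡ 0ℤ
δ-≢ {s = s} {t} s≢t with s ≟ t
... | yes s≡t = ⊥-elim (s≢t s≡t)
... | no _    = refl

lincomb-closed : ∀ {k m} {M : (Fin k → ℤ) → Set} → IsSubmodule M →
                 ∀ (S : Subset m) c (x : Fin m → Fin k → ℤ) →
                 (∀ e → lookup S e ≡ true → M (x e)) → M (lincomb S c x)
lincomb-closed (𝟎∈M , _) [] c x x∈M = 𝟎∈M
lincomb-closed {M = M} M-submodule@(_ , ⊕-closed , ·-closed , respects) (b ∷ S) c x x∈M =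
  cons-closed b (x∈M zero) (lincomb-closed M-submodule S (c ∘ suc) (x ∘ suc) (x∈M ∘ suc))
  where
  cons-closed : ∀ b → (b ≡ true → M (x zero)) → M (lincomb S (c ∘ suc) (x ∘ suc)) →
                M (lincomb (b ∷ S) c x)
  cons-closed true  x₀∈M tail∈M = ⊕-closed _ _ (·-closed (c zero) (x zero) (x₀∈M refl)) tail∈M
  cons-closed false _    tail∈M = respects _ _ (λ i → sym (+-identityˡ _)) tail∈M

module _ {m} (S : Subset m) (c : Fin m → ℤ) (x : Fin m → C¹ m) where

  lincomb-vanishes : (∀ e → lookup S e ≡ true → c e ≡ 0ℤ) → lincomb S c x ≋ 𝟎
  lincomb-vanishes c≡0 i = Σℤ-zero _ term≡0
    where
    term≡0 : ∀ e → (if lookup S e then c e * x e i else 0ℤ) ≡ 0ℤ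
    term≡0 e with lookup S e in e∈S
    ... | true  = trans (cong (_* x e i) (c≡0 e e∈S)) (*-zeroˡ (x e i))
    ... | false = refl

  lincomb-coordinate : (∀ s t → lookup S s ≡ true → lookup S t ≡ true → x s t ≡ δ s t) →
                       ∀ t → lookup S t ≡ true → lincomb S c x t ≡ c t
  lincomb-coordinate dual t t∈S = trans (Σℤ-single t _ offDiagonal) diagonal
    where
    offDiagonal : ∀ s → s ≢ t → (if lookup S s then c s * x s t else 0ℤ) ≡ 0ℤ
    offDiagonal s s≢t with lookup S s in s∈S
    ... | true  = trans (cong (c s *_) (trans (dual s t s∈S t∈S) (δ-≢ s≢t))) (*-zeroʳ (c s))
    ... | false = refl

    diagonal : (if lookup S t then c t * x t t else 0ℤ) ≡ c t
    diagonal rewrite t∈S =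
      trans (cong (c t *_) (trans (dual t t t∈S t∈S) (δ-refl t))) (*-identityʳ (c t))

VanishesOn : ∀ {m} → Subset m → C¹ m → Set
VanishesOn T y = ∀ t → lookup T t ≡ true → y t ≡ 0ℤ

VanishesOn-isSubmodule : ∀ {m} (T : Subset m) → IsSubmodule (VanishesOn T)
VanishesOn-isSubmodule T =
  (λ t _ → refl) ,
  (λ a b a|T≡0 b|T≡0 t t∈T → cong₂ _+_ (a|T≡0 t t∈T) (b|T≡0 t t∈T)) ,
  (λ c a a|T≡0 t t∈T → trans (cong (c *_) (a|T≡0 t t∈T)) (*-zeroʳ c)) ,
  (λ a b a≋b a|T≡0 t t∈T → trans (sym (a≋b t)) (a|T≡0 t t∈T))

i+[j-i]≡j : ∀ i j → i + (j - i) ≡ j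
i+[j-i]≡j = solve-∀

dualGenerators⇒IsDirectSummand :
  ∀ {m} {M : C¹ m → Set} → IsSubmodule M → (T : Subset m) (x : Fin m → C¹ m) →
  (∀ t → lookup T t ≡ true → M (x t)) →
  (∀ y → M y → ∃[ c ] (lincomb T c x ≋ y)) →
  (∀ t t' → lookup T t ≡ true → lookup T t' ≡ true → x t t' ≡ δ t t') →
  IsDirectSummand M
dualGenerators⇒IsDirectSummand {M = M} M-submodule T x x∈M M⊆span dual =
  VanishesOn T , VanishesOn-isSubmodule T , decompose , intersect
  where
  decompose : ∀ y → ∃[ a ] ∃[ b ] (M a × VanishesOn T b × (a ⊕ b) ≋ y)
  decompose y = p , (λ i → y i - p i) , lincomb-closed M-submodule T y x x∈M ,
                (λ t t∈T → trans (cong (y t -_) (lincomb-coordinate T y x dual t t∈T))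
                                 (+-inverseʳ (y t))) ,
                (λ i → i+[j-i]≡j (p i) (y i))
    where p = lincomb T y x

  intersect : ∀ y → M y → VanishesOn T y → y ≋ 𝟎
  intersect y y∈M y|T≡0 with M⊆span y y∈M
  ... | c , c·x≋y = λ i → trans (sym (c·x≋y i)) (lincomb-vanishes T c x c|T≡0 i)
    where
    c|T≡0 : ∀ t → lookup T t ≡ true → c t ≡ 0ℤ
    c|T≡0 t t∈T = trans (sym (lincomb-coordinate T c x dual t t∈T))
                        (trans (c·x≋y t) (y|T≡0 t t∈T))

module _ {n m} (H : OrientedHypergraph n m) where

  δ⁰-⊕ : ∀ φ ψ → δ⁰ H (φ ⊕ ψ) ≋ (δ⁰ H φ ⊕ δ⁰ H ψ)
  δ⁰-⊕ φ ψ e = begin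
    δ⁰ H (φ ⊕ ψ) e                             ≡⟨ Σℤ≡sum {n} _ ⟩
    sum {n} (λ v → (φ v + ψ v) * ∂e v)         ≡⟨ sum-cong-≗ (λ v → *-distribʳ-+ (∂e v) (φ v) (ψ v)) ⟩
    sum {n} (λ v → φ v * ∂e v + ψ v * ∂e v)    ≡⟨ ∑-distrib-+ (λ v → φ v * ∂e v) (λ v → ψ v * ∂e v) ⟩
    sum (λ v → φ v * ∂e v) + sum (λ v → ψ v * ∂e v)
                                               ≡⟨ sym (cong₂ _+_ (Σℤ≡sum {n} _) (Σℤ≡sum {n} _)) ⟩
    δ⁰ H φ e + δ⁰ H ψ e                        ∎
    where
    open ≡-Reasoning
    ∂e : Fin n → ℤ
    ∂e = inc H e

  δ⁰-· : ∀ c φ → δ⁰ H (c · φ) ≋ (c · δ⁰ H φ)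
  δ⁰-· c φ e = begin
    δ⁰ H (c · φ) e                    ≡⟨ Σℤ≡sum {n} _ ⟩
    sum {n} (λ v → c * φ v * ∂e v)    ≡⟨ sum-cong-≗ (λ v → *-assoc c (φ v) (∂e v)) ⟩
    sum {n} (λ v → c * (φ v * ∂e v))  ≡⟨ sym (*-distribˡ-sum c (λ v → φ v * ∂e v)) ⟩
    c * sum (λ v → φ v * ∂e v)        ≡⟨ sym (cong (c *_) (Σℤ≡sum {n} _)) ⟩
    c * δ⁰ H φ e                      ∎
    where
    open ≡-Reasoning
    ∂e : Fin n → ℤ
    ∂e = inc H e

  δ⁰-𝟎 : δ⁰ H 𝟎 ≋ 𝟎
  δ⁰-𝟎 e = Σℤ-zero {n} _ (λ v → *-zeroˡ (inc H e v))

  ImDelta0-isSubmodule : IsSubmodule (ImDelta0 H)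
  ImDelta0-isSubmodule =
    (𝟎 , δ⁰-𝟎) ,
    (λ { a b (φ , φ↦a) (ψ , ψ↦b) →
           φ ⊕ ψ , λ e → trans (δ⁰-⊕ φ ψ e) (cong₂ _+_ (φ↦a e) (ψ↦b e)) }) ,
    (λ { c a (φ , φ↦a) → c · φ , λ e → trans (δ⁰-· c φ e) (cong (c *_) (φ↦a e)) }) ,
    (λ { a b a≋b (φ , φ↦a) → φ , λ e → trans (φ↦a e) (a≋b e) })

theorem22 : ∀ {n m} (H : OrientedHypergraph n m) →
    ∃[ T ] IsAlgebraicSpanningTree H T →
    IsDirectSummand (ImDelta0 H)
theorem22 H (T , ((x , (x∈ℬ , _ , ℬ⊆span) , dual) , _)) =
  dualGenerators⇒IsDirectSummand (ImDelta0-isSubmodule H) T x x∈ℬ ℬ⊆span dual
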